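{- Consider algorithm \textsf{A} (defined below) at some moment just before a \textsc{shortcut}, and let $n'$ be the number of green vertices at that moment. Renumber the green vertices $1,\dots,n'$ in increasing order of their original numbers, and for a green non-root $v$ define its level $v.l=\lfloor \lg(v-v.p)\rfloor$ in the new numbering. Let $x_1,x_2,\dots,x_{k+2}$ be green vertices with $x_{i+1}=x_i.p$ for $1\le i\le k+1$ (a tree path of $k+2$ green vertices), where $k\ge 2\lg n'$. Then the \textsc{shortcut} increases the sum of the levels of the non-root vertices among $x_1,\dots,x_{k+2}$ by at least $k/4$ (levels after the \textsc{shortcut} being computed with the same renumbering).
   Context: Each edge $e$ has two ends $e.v,e.w$; the current edge set is initially the input edge set. Each vertex $v$ has a parent $v.p$, initially $v$; $v$ is a root if $v.p=v$. Vertices are compared as integers. Each operation is performed simultaneously for all edges/vertices using values at the start of the operation. \textsc{connect}: for each current edge $e$, send $\min\{e.v,e.w\}$ to $\max\{e.v,e.w\}$. \textsc{update}: for each vertex $v$, replace $v.p$ by the minimum of $v.p$ and the vertices sent to $v$ in the preceding \textsc{connect}. \textsc{shortcut}: for each vertex $v$, replace $v.p$ by $(v.p).p$. \textsc{alter}: for each edge $e$, let $x=e.v.p$, $y=e.w.p$; replace $e.v,e.w$ by $x,y$ (the algorithm deletes the edge when $x=y$; for the analysis it is instead kept as the loop $(x,x)$). Algorithm \textsf{A}: repeat \{\textsc{connect}; \textsc{update}; \textsc{shortcut}; \textsc{alter}\} until no parent changes. A vertex is green if it is a root or is an end of some current edge (loops included), and red otherwise. In \textsf{A}, the parent and grandparent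 of a green non-root are green, so levels are well defined. $\lg$ is the base-two logarithm. -}

module Defs where

open import Data.Nat using (ℕ; zero; suc; _+_; _*_; _∸_; _≤_; _<_; _≤ᵇ_; _<ᵇ_)
open import Data.Nat.Logarithm using (⌊log₂_⌋)
open import Data.Nat.ListAction using (sum)
open import Data.Fin using (Fin; toℕ; _≟_)
open import Data.List using (List; []; _∷_; foldr; map; filter; length)
open import Data.Bool.ListAction using (any)
open import Data.List.Base using (allFin)
open import Data.Product using (_×_; _,_; proj₁; proj₂; Σ)
open import Data.Bool using (Bool; true; false; if_then_else_; _∨_; _∧_)
open import Relation.Nullary using (¬_)
open import Relation.Nullary.Decidable using (⌊_⌋)
open import Relation.Binary.PropositionalEquality using (_≡_)

Edge : ℕ → Set
Edge n = Fin n × Fin n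

minV : ∀ {n} → Fin n → Fin n → Fin n
minV a b = if toℕ a ≤ᵇ toℕ b then a else b

maxV : ∀ {n} → Fin n → Fin n → Fin n
maxV a b = if toℕ a ≤ᵇ toℕ b then b else a

-- State of algorithm A: parent pointers and current edge set
-- (loops are kept, as in the analysis).
record State (n : ℕ) : Set where
  constructor st
  field
    par   : Fin n → Fin n
    edges : List (Edge n)
open State public

initial : ∀ {n} → List (Edge n) → State n
initial E = st (λ v → v) E

-- CONNECT followed by UPDATE: v.p := min (v.p, all min{e.v,e.w} with max{e.v,e.w} = v)
connectUpdate : ∀ {n} → State n → State n
connectUpdate s = st newp (edges s)
  where
  newp : _ → _
  newp v = foldr (λ e acc → if ⌊ maxV (proj₁ e) (proj₂ e) ≟ v ⌋
                             then minV acc (minV (proj₁ e) (proj₂ e))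
                             else acc)
                 (par s v) (edges s)

shortcut : ∀ {n} → State n → State n
shortcut s = st (λ v → par s (par s v)) (edges s)

alter : ∀ {n} → State n → State n
alter s = st (par s) (map (λ e → par s (proj₁ e) , par s (proj₂ e)) (edges s))

round : ∀ {n} → State n → State n
round s = alter (shortcut (connectUpdate s))

iterate : ∀ {n} → ℕ → State n → State n
iterate zero    s = s
iterate (suc t) s = round (iterate t s)

changesParent : ∀ {n} → State n → Set
changesParent {n} s = Σ (Fin n) λ v → ¬ (par (round s) v ≡ par s v)

-- the state just before the SHORTCUT of iteration t+1 of A on input E
beforeShortcut : ∀ {n} → List (Edge n) → ℕ → State n
beforeShortcut E t = connectUpdate (iterate t (initial E))

isRoot : ∀ {n} → State n → Fin n → Bool
isRoot s v = ⌊ par s v ≟ v ⌋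

greenB : ∀ {n} → State n → Fin n → Bool
greenB s v = isRoot s v ∨ any (λ e → ⌊ proj₁ e ≟ v ⌋ ∨ ⌊ proj₂ e ≟ v ⌋) (edges s)

Green : ∀ {n} → State n → Fin n → Set
Green s v = greenB s v ≡ true

numGreen : ∀ {n} → State n → ℕ
numGreen {n} s = length (filter (λ v → greenB s v ≡? true) (allFin n))
  where
  open import Data.Bool.Properties using () renaming (_≟_ to _≡?_)

-- new number (1..n') of a vertex in the renumbering of the green vertices of s:
-- the number of green vertices that are ≤ v
rank : ∀ {n} → State n → Fin n → ℕ
rank {n} s v = length (filter (λ w → greenB s w ∧ (toℕ w ≤ᵇ toℕ v) ≡? true) (allFin n))
  where
  open import Data.Bool.Properties using () renaming (_≟_ to _≡?_)

level : ∀ {n} → State n → (Fin n → Fin n) → Fin n → ℕ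
level s q v = ⌊log₂ (rank s v ∸ rank s (q v)) ⌋

levelSum : ∀ {n m} → State n → (Fin n → Fin n) → (Fin m → Fin n) → ℕ
levelSum {m = m} s q x =
  sum (map (λ i → if ⌊ q (x i) ≟ x i ⌋ then 0 else level s q (x i)) (allFin m))

module Submission where

-- Write r for the renumbering of the green vertices, o(v) = ⌊lg (r v - r v.p)⌋
-- for the level before and n(v) = ⌊lg (r v - r v.p.p)⌋ for the level after the
-- shortcut.  Parents never exceed their children in A, so r v > r v.p > r v.p.p
-- along the path, and the key inequality 1 + lg a + lg b ≤ 2 lg (a + b) gives,
-- for two consecutive non-roots v, v.p of the path,
--     1 + o(v) + o(v.p) ≤ 2 n(v).
-- Summing these k inequalities (a telescoping argument, together with
-- o ≤ n everywhere) yields 2 Σo + k ≤ 2 Σn + o(x₁), and o(x₁) ≤ lg n' ≤ k/2.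

open import Defs
open import Data.Nat
  using (ℕ; zero; suc; _+_; _*_; _^_; _∸_; _≤_; _<_; _≤ᵇ_; z≤n; s≤s; ⌊_/2⌋)
open import Data.Nat.Properties hiding (_≟_)
open import Data.Nat.Logarithm
  using (⌊log₂_⌋; ⌊log₂⌋-mono-≤; ⌊log₂⌊n/2⌋⌋≡⌊log₂n⌋∸1; ⌊log₂[2*b]⌋≡1+⌊log₂b⌋; ⌊log₂[2^n]⌋≡n)
open import Data.Nat.ListAction using (sum)
open import Data.Nat.Tactic.RingSolver using (solve)
open import Data.Bool using (true; false; if_then_else_; _∧_)
open import Data.Bool.Properties using (T-≡) renaming (_≟_ to _≟ᵇ_)
open import Data.Fin using (Fin; zero; suc; inject₁; toℕ; _≟_)
open import Data.Fin.Properties using (toℕ-injective; toℕ-inject₁)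
open import Data.List using (List; []; _∷_; foldr; filter; length; tabulate; allFin)
open import Data.List.Properties using (map-tabulate)
open import Data.List.Membership.Propositional using (_∈_)
open import Data.List.Membership.Propositional.Properties using (∈-allFin)
open import Data.List.Relation.Unary.Any using (here; there)
open import Data.List.Relation.Binary.Sublist.Propositional using (⊆-refl)
open import Data.List.Relation.Binary.Sublist.Propositional.Properties
  using (filter⁺; length-mono-≤)
open import Data.Product using (proj₁; proj₂)
open import Data.Sum using (inj₁; inj₂)
open import Function using (id; _∘_)
open import Level using (0ℓ)
open import Function.Bundles using (Equivalence)
open import Function.Definitions using (Injective)
open import Relation.Nullary using (¬_; yes; no; contradiction)
open import Relation.Nullary.Decidable using (⌊_⌋)
open import Relation.Nullary.Reflects using (ofⁿ)
open import Relation.Unary using (Pred; Decidable)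
open import Relation.Binary.PropositionalEquality

ParentsBelow : ∀ {n} → State n → Set
ParentsBelow {n} s = ∀ (v : Fin n) → toℕ (par s v) ≤ toℕ v

foldr-decreasing : ∀ {n} {E : Set} (f : E → Fin n → Fin n)
                   → (∀ e acc → toℕ (f e acc) ≤ toℕ acc)
                   → ∀ a es → toℕ (foldr f a es) ≤ toℕ a
foldr-decreasing f dec a []       = ≤-refl
foldr-decreasing f dec a (e ∷ es) = ≤-trans (dec e _) (foldr-decreasing f dec a es)

minV-≤ˡ : ∀ {n} (a b : Fin n) → toℕ (minV a b) ≤ toℕ a
minV-≤ˡ a b with toℕ a ≤ᵇ toℕ b | ≤ᵇ-reflects-≤ (toℕ a) (toℕ b)
... | true  | _      = ≤-refl
... | false | ofⁿ a≰b = <⇒≤ (≰⇒> a≰b)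

connectUpdate-decreases : ∀ {n} (s : State n) (v : Fin n)
                          → toℕ (par (connectUpdate s) v) ≤ toℕ (par s v)
connectUpdate-decreases s v = foldr-decreasing _ step (par s v) (edges s)
  where
  step : ∀ e acc → toℕ (if ⌊ maxV (proj₁ e) (proj₂ e) ≟ v ⌋
                          then minV acc (minV (proj₁ e) (proj₂ e)) else acc) ≤ toℕ acc
  step e acc with ⌊ maxV (proj₁ e) (proj₂ e) ≟ v ⌋
  ... | true  = minV-≤ˡ acc _
  ... | false = ≤-refl

connectUpdate-parentsBelow : ∀ {n} (s : State n) → ParentsBelow s → ParentsBelow (connectUpdate s)
connectUpdate-parentsBelow s below v = ≤-trans (connectUpdate-decreases s v) (below v)

shortcut-parentsBelow : ∀ {n} (s : State n) → ParentsBelow s → ParentsBelow (shortcut s)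
shortcut-parentsBelow s below v = ≤-trans (below (par s v)) (below v)

iterate-parentsBelow : ∀ {n} t (s : State n) → ParentsBelow s → ParentsBelow (iterate t s)
iterate-parentsBelow zero    s below = below
iterate-parentsBelow (suc t) s below =
  shortcut-parentsBelow (connectUpdate (iterate t s))
    (connectUpdate-parentsBelow (iterate t s) (iterate-parentsBelow t s below))

beforeShortcut-parentsBelow : ∀ {n} (E : List (Edge n)) t → ParentsBelow (beforeShortcut E t)
beforeShortcut-parentsBelow E t =
  connectUpdate-parentsBelow (iterate t (initial E))
    (iterate-parentsBelow t (initial E) (λ _ → ≤-refl))

module _ {A : Set} {P Q : Pred A 0ℓ} (P? : Decidable P) (Q? : Decidable Q)
         (P⇒Q : ∀ {w} → P w → Q w) where

  filter-length-mono : ∀ xs → length (filter P? xs) ≤ length (filter Q? xs)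
  filter-length-mono xs = length-mono-≤ (filter⁺ P? Q? (λ { refl → P⇒Q }) (⊆-refl {x = xs}))

  filter-length-strict : ∀ {y} xs → y ∈ xs → Q y → ¬ P y
                         → length (filter P? xs) < length (filter Q? xs)
  filter-length-strict (y ∷ xs) (here refl) qy ¬py with P? y | Q? y
  ... | yes py | _     = contradiction py ¬py
  ... | no _   | yes _ = s≤s (filter-length-mono xs)
  ... | no _   | no ¬qy = contradiction qy ¬qy
  filter-length-strict (x ∷ xs) (there y∈xs) qy ¬py with P? x | Q? x
  ... | yes px | yes _   = s≤s (filter-length-strict xs y∈xs qy ¬py)
  ... | yes px | no ¬qx  = contradiction (P⇒Q px) ¬qx
  ... | no _   | yes _   = m≤n⇒m≤1+n (filter-length-strict xs y∈xs qy ¬py)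
  ... | no _   | no _    = filter-length-strict xs y∈xs qy ¬py

module Renumbering {n : ℕ} (s : State n) where

  GreenUpTo : Fin n → Pred (Fin n) 0ℓ
  GreenUpTo v w = (greenB s w ∧ (toℕ w ≤ᵇ toℕ v)) ≡ true

  greenUpTo? : ∀ v → Decidable (GreenUpTo v)
  greenUpTo? v w = greenB s w ∧ (toℕ w ≤ᵇ toℕ v) ≟ᵇ true

  greenUpTo-intro : ∀ {v w} → Green s w → toℕ w ≤ toℕ v → GreenUpTo v w
  greenUpTo-intro g w≤v rewrite g = Equivalence.to T-≡ (≤⇒≤ᵇ w≤v)

  greenUpTo-green : ∀ {v w} → GreenUpTo v w → Green s w
  greenUpTo-green {w = w} counted with greenB s w
  ... | true  = refl
  ... | false = counted

  greenUpTo-≤ : ∀ {v w} → GreenUpTo v w → toℕ w ≤ toℕ v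
  greenUpTo-≤ {v} {w} counted with greenB s w
  ... | true  = ≤ᵇ⇒≤ (toℕ w) (toℕ v) (Equivalence.from T-≡ counted)
  ... | false = contradiction counted λ ()

  rank≤numGreen : ∀ v → rank s v ≤ numGreen s
  rank≤numGreen v = filter-length-mono (greenUpTo? v) (λ w → greenB s w ≟ᵇ true)
                      greenUpTo-green (allFin n)

  rank-mono : ∀ {a b} → toℕ a ≤ toℕ b → rank s a ≤ rank s b
  rank-mono a≤b = filter-length-mono (greenUpTo? _) (greenUpTo? _)
                    (λ u → greenUpTo-intro (greenUpTo-green u) (≤-trans (greenUpTo-≤ u) a≤b))
                    (allFin n)

  rank-strict : ∀ {a b} → Green s b → toℕ a < toℕ b → rank s a < rank s b
  rank-strict {b = b} gb a<b =
    filter-length-strict (greenUpTo? _) (greenUpTo? _)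
      (λ u → greenUpTo-intro (greenUpTo-green u) (≤-trans (greenUpTo-≤ u) (<⇒≤ a<b)))
      (allFin n) (∈-allFin b) (greenUpTo-intro gb ≤-refl) (λ u → <⇒≱ a<b (greenUpTo-≤ u))

2*⌊n/2⌋≤n : ∀ m → 2 * ⌊ m /2⌋ ≤ m
2*⌊n/2⌋≤n zero          = z≤n
2*⌊n/2⌋≤n (suc zero)    = z≤n
2*⌊n/2⌋≤n (suc (suc m)) = subst (_≤ suc (suc m)) (sym (*-suc 2 ⌊ m /2⌋)) (s≤s (s≤s (2*⌊n/2⌋≤n m)))

2^⌊log₂⌋≤ : ∀ j m → ⌊log₂ suc m ⌋ ≡ j → 2 ^ j ≤ suc m
2^⌊log₂⌋≤ zero    m       _  = s≤s z≤n
2^⌊log₂⌋≤ (suc j) (suc m) lg≡ = begin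
    2 * 2 ^ j                       ≤⟨ *-monoʳ-≤ 2 (2^⌊log₂⌋≤ j ⌊ m /2⌋ lg-half≡) ⟩
    2 * ⌊ suc (suc m) /2⌋           ≤⟨ 2*⌊n/2⌋≤n (suc (suc m)) ⟩
    suc (suc m)                     ∎
  where
  open ≤-Reasoning
  lg-half≡ : ⌊log₂ suc ⌊ m /2⌋ ⌋ ≡ j
  lg-half≡ = trans (⌊log₂⌊n/2⌋⌋≡⌊log₂n⌋∸1 (suc (suc m))) (cong (_∸ 1) lg≡)

⌊log₂⌋-square : ∀ N k → N * N ≤ 2 ^ k → ⌊log₂ N ⌋ + ⌊log₂ N ⌋ ≤ k
⌊log₂⌋-square zero    k _     = z≤n
⌊log₂⌋-square (suc m) k N²≤2^k = begin
    L + L              ≡⟨ ⌊log₂[2^n]⌋≡n (L + L) ⟨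
    ⌊log₂ 2 ^ (L + L) ⌋ ≤⟨ ⌊log₂⌋-mono-≤ 2^[L+L]≤2^k ⟩
    ⌊log₂ 2 ^ k ⌋       ≡⟨ ⌊log₂[2^n]⌋≡n k ⟩
    k                  ∎
  where
  open ≤-Reasoning
  L : ℕ
  L = ⌊log₂ suc m ⌋
  2^L≤N : 2 ^ L ≤ suc m
  2^L≤N = 2^⌊log₂⌋≤ L m refl
  2^[L+L]≤2^k : 2 ^ (L + L) ≤ 2 ^ k
  2^[L+L]≤2^k = ≤-trans (≤-reflexive (^-distribˡ-+-* 2 L L)) (≤-trans (*-mono-≤ 2^L≤N 2^L≤N) N²≤2^k)

-- The key inequality 1 + ⌊lg a⌋ + ⌊lg b⌋ ≤ 2 ⌊lg (a + b)⌋ for a, b ≥ 1,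
-- first when a ≤ b: then 1 + ⌊lg a⌋ = ⌊lg 2a⌋ ≤ ⌊lg (a + b)⌋.
⌊log₂⌋-sum-ordered : ∀ a b → 1 ≤ a → a ≤ b → 1 + ⌊log₂ a ⌋ + ⌊log₂ b ⌋ ≤ 2 * ⌊log₂ (a + b) ⌋
⌊log₂⌋-sum-ordered a@(suc _) b _ a≤b = begin
    1 + ⌊log₂ a ⌋ + ⌊log₂ b ⌋          ≡⟨ cong (_+ ⌊log₂ b ⌋) (⌊log₂[2*b]⌋≡1+⌊log₂b⌋ a) ⟨
    ⌊log₂ 2 * a ⌋ + ⌊log₂ b ⌋          ≤⟨ +-mono-≤ (⌊log₂⌋-mono-≤ 2a≤a+b) (⌊log₂⌋-mono-≤ (m≤n+m b a)) ⟩
    ⌊log₂ (a + b) ⌋ + ⌊log₂ (a + b) ⌋  ≡⟨ cong (⌊log₂ (a + b) ⌋ +_) (+-identityʳ _) ⟨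
    2 * ⌊log₂ (a + b) ⌋                ∎
  where
  open ≤-Reasoning
  2a≤a+b : 2 * a ≤ a + b
  2a≤a+b = +-monoʳ-≤ a (≤-trans (≤-reflexive (+-identityʳ a)) a≤b)

⌊log₂⌋-sum : ∀ a b → 1 ≤ a → 1 ≤ b → 1 + ⌊log₂ a ⌋ + ⌊log₂ b ⌋ ≤ 2 * ⌊log₂ (a + b) ⌋
⌊log₂⌋-sum a b 1≤a 1≤b with ≤-total a b
... | inj₁ a≤b = ⌊log₂⌋-sum-ordered a b 1≤a a≤b
... | inj₂ b≤a = subst₂ _≤_ (cong suc (+-comm ⌊log₂ b ⌋ ⌊log₂ a ⌋))
                            (cong (λ c → 2 * ⌊log₂ c ⌋) (+-comm b a))
                            (⌊log₂⌋-sum-ordered b a 1≤b b≤a)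

telescope-step : ∀ o₀ o₁ n₀ A B k → 1 + o₀ + o₁ ≤ 2 * n₀ → 2 * A + k ≤ 2 * B + o₁
                 → 2 * (o₀ + A) + suc k ≤ 2 * (n₀ + B) + o₀
telescope-step o₀ o₁ n₀ A B k gain rest = begin
    2 * (o₀ + A) + suc k         ≡⟨ solve (o₀ ∷ A ∷ k ∷ []) ⟩
    o₀ + (suc o₀ + (2 * A + k))  ≤⟨ +-monoʳ-≤ o₀ (+-monoʳ-≤ (suc o₀) rest) ⟩
    o₀ + (suc o₀ + (2 * B + o₁)) ≡⟨ solve (o₀ ∷ o₁ ∷ B ∷ []) ⟩
    o₀ + (2 * B + (1 + o₀ + o₁)) ≤⟨ +-monoʳ-≤ o₀ (+-monoʳ-≤ (2 * B) gain) ⟩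
    o₀ + (2 * B + 2 * n₀)        ≡⟨ solve (o₀ ∷ n₀ ∷ B ∷ []) ⟩
    2 * (n₀ + B) + o₀            ∎
  where open ≤-Reasoning

telescope : ∀ k (o n : Fin (2 + k) → ℕ) → (∀ i → o i ≤ n i)
            → (∀ (i : Fin k) → 1 + o (inject₁ (inject₁ i)) + o (suc (inject₁ i))
                                 ≤ 2 * n (inject₁ (inject₁ i)))
            → 2 * sum (tabulate o) + k ≤ 2 * sum (tabulate n) + o zero
telescope zero    o n o≤n _    = begin
    2 * sum (tabulate o) + 0  ≡⟨ +-identityʳ _ ⟩
    2 * sum (tabulate o)      ≤⟨ *-monoʳ-≤ 2 (+-mono-≤ (o≤n zero) (+-monoˡ-≤ 0 (o≤n (suc zero)))) ⟩
    2 * sum (tabulate n)      ≤⟨ m≤m+n _ (o zero) ⟩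
    2 * sum (tabulate n) + o zero ∎
  where open ≤-Reasoning
telescope (suc k) o n o≤n gain =
  telescope-step (o zero) (o (suc zero)) (n zero) _ _ k (gain zero)
    (telescope k (o ∘ suc) (n ∘ suc) (o≤n ∘ suc) (gain ∘ suc))

absorb-slack : ∀ A B c k → 2 * A + k ≤ 2 * B + c → c + c ≤ k → 4 * A + k ≤ 4 * B
absorb-slack A B c k 2A+k≤2B+c 2c≤k = +-cancelʳ-≤ k _ _ (begin
    (4 * A + k) + k   ≡⟨ solve (A ∷ k ∷ []) ⟩
    2 * (2 * A + k)   ≤⟨ *-monoʳ-≤ 2 2A+k≤2B+c ⟩
    2 * (2 * B + c)   ≡⟨ solve (B ∷ c ∷ []) ⟩
    4 * B + (c + c)   ≤⟨ +-monoʳ-≤ (4 * B) 2c≤k ⟩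
    4 * B + k         ∎)
  where open ≤-Reasoning

module Levels {n : ℕ} (s : State n) (below : ParentsBelow s) where
  open Renumbering s

  p : Fin n → Fin n
  p = par s

  oldLevel newLevel : Fin n → ℕ
  oldLevel v = if ⌊ p v ≟ v ⌋ then 0 else level s p v
  newLevel v = if ⌊ p (p v) ≟ v ⌋ then 0 else level s (p ∘ p) v

  oldLevel-nonroot : ∀ {v} → p v ≢ v → oldLevel v ≡ ⌊log₂ (rank s v ∸ rank s (p v)) ⌋
  oldLevel-nonroot {v} nonroot with p v ≟ v
  ... | yes root = contradiction root nonroot
  ... | no _     = refl

  newLevel-nonroot : ∀ {v} → p (p v) ≢ v → newLevel v ≡ ⌊log₂ (rank s v ∸ rank s (p (p v))) ⌋
  newLevel-nonroot {v} nonroot with p (p v) ≟ v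
  ... | yes root = contradiction root nonroot
  ... | no _     = refl

  parent-< : ∀ {v} → p v ≢ v → toℕ (p v) < toℕ v
  parent-< {v} nonroot = ≤∧≢⇒< (below v) (nonroot ∘ toℕ-injective)

  grandparent-≢ : ∀ {v} → p v ≢ v → p (p v) ≢ v
  grandparent-≢ {v} nonroot pp≡v =
    <-irrefl (cong toℕ pp≡v) (≤-<-trans (below (p v)) (parent-< nonroot))

  oldLevel≤newLevel : ∀ v → oldLevel v ≤ newLevel v
  oldLevel≤newLevel v with p v ≟ v
  ... | yes _       = z≤n
  ... | no nonroot  = subst (level s p v ≤_) (sym (newLevel-nonroot (grandparent-≢ nonroot)))
                        (⌊log₂⌋-mono-≤ (∸-monoʳ-≤ (rank s v) (rank-mono (below (p v)))))

  oldLevel≤⌊log₂numGreen⌋ : ∀ v → oldLevel v ≤ ⌊log₂ numGreen s ⌋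
  oldLevel≤⌊log₂numGreen⌋ v with p v ≟ v
  ... | yes _ = z≤n
  ... | no _  = ⌊log₂⌋-mono-≤ (≤-trans (m∸n≤m (rank s v) (rank s (p v))) (rank≤numGreen v))

  two-step-gain : ∀ a → Green s a → Green s (p a) → p a ≢ a → p (p a) ≢ p a
                  → 1 + oldLevel a + oldLevel (p a) ≤ 2 * newLevel a
  two-step-gain a green-a green-b a-nonroot b-nonroot = begin
      1 + oldLevel a + oldLevel (p a)
    ≡⟨ cong₂ (λ x y → 1 + x + y) (oldLevel-nonroot a-nonroot) (oldLevel-nonroot b-nonroot) ⟩
      1 + ⌊log₂ (ra ∸ rb) ⌋ + ⌊log₂ (rb ∸ rc) ⌋
    ≤⟨ ⌊log₂⌋-sum _ _ (m<n⇒0<n∸m rb<ra) (m<n⇒0<n∸m rc<rb) ⟩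
      2 * ⌊log₂ ((ra ∸ rb) + (rb ∸ rc)) ⌋
    ≡⟨ cong (λ d → 2 * ⌊log₂ d ⌋) (∸-split (<⇒≤ rc<rb) (<⇒≤ rb<ra)) ⟩
      2 * ⌊log₂ (ra ∸ rc) ⌋
    ≡⟨ cong (2 *_) (newLevel-nonroot (grandparent-≢ a-nonroot)) ⟨
      2 * newLevel a
    ∎
    where
    open ≤-Reasoning
    ra rb rc : ℕ
    ra = rank s a
    rb = rank s (p a)
    rc = rank s (p (p a))
    rb<ra : rb < ra
    rb<ra = rank-strict green-a (parent-< a-nonroot)
    rc<rb : rc < rb
    rc<rb = rank-strict green-b (parent-< b-nonroot)
    ∸-split : ∀ {x y z} → z ≤ y → y ≤ x → (x ∸ y) + (y ∸ z) ≡ x ∸ z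
    ∸-split {x} {y} {z} z≤y y≤x = begin-equality
      (x ∸ y) + (y ∸ z) ≡⟨ +-∸-assoc (x ∸ y) z≤y ⟨
      (x ∸ y) + y ∸ z   ≡⟨ cong (_∸ z) (m∸n+n≡m y≤x) ⟩
      x ∸ z             ∎

  -- Along an injective tree path x₀ … x_{m+1} of green vertices every vertex
  -- but the last is a non-root, so the local inequality applies to each of
  -- the first m pairs of consecutive vertices.
  module TreePath {m : ℕ} (x : Fin (2 + m) → Fin n) (injective : Injective _≡_ _≡_ x)
                  (green : ∀ i → Green s (x i))
                  (path : ∀ (i : Fin (suc m)) → x (suc i) ≡ p (x (inject₁ i))) where

    nonroot : ∀ (i : Fin (suc m)) → p (x (inject₁ i)) ≢ x (inject₁ i)
    nonroot i root = 1+n≢n (trans (cong toℕ (injective (trans (path i) root))) (toℕ-inject₁ i))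

    gain : ∀ (i : Fin m) → 1 + oldLevel (x (inject₁ (inject₁ i))) + oldLevel (x (suc (inject₁ i)))
                             ≤ 2 * newLevel (x (inject₁ (inject₁ i)))
    gain i with x (suc (inject₁ i)) | path (inject₁ i) | green (suc (inject₁ i)) | nonroot (suc i)
    ... | _ | refl | green-b | b-nonroot =
      two-step-gain _ (green (inject₁ (inject₁ i))) green-b (nonroot (inject₁ i)) b-nonroot

levelSum-tabulate : ∀ {n m} (s : State n) (q : Fin n → Fin n) (x : Fin m → Fin n)
                    → levelSum s q x
                      ≡ sum (tabulate (λ i → if ⌊ q (x i) ≟ x i ⌋ then 0 else level s q (x i)))
levelSum-tabulate {m = m} s q x =
  cong sum (map-tabulate {n = m} id (λ i → if ⌊ q (x i) ≟ x i ⌋ then 0 else level s q (x i)))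

lemma18 : ∀ {n} (E : List (Edge n)) (t : ℕ)
          → (∀ j → j < t → changesParent (iterate j (initial E)))
          → (k : ℕ)
          → numGreen (beforeShortcut E t) * numGreen (beforeShortcut E t) ≤ 2 ^ k
          → (x : Fin (2 + k) → Fin n)
          → Injective _≡_ _≡_ x
          → (∀ i → Green (beforeShortcut E t) (x i))
          → (∀ (i : Fin (suc k)) → x (suc i) ≡ par (beforeShortcut E t) (x (inject₁ i)))
          → 4 * levelSum (beforeShortcut E t) (par (beforeShortcut E t)) x + k
            ≤ 4 * levelSum (beforeShortcut E t) (par (shortcut (beforeShortcut E t))) x
lemma18 E t _ k n'²≤2^k x injective green path =
  subst₂ (λ A B → 4 * A + k ≤ 4 * B)
    (sym (levelSum-tabulate s (par s) x)) (sym (levelSum-tabulate s (par (shortcut s)) x))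
    (absorb-slack (sum (tabulate (oldLevel ∘ x))) (sum (tabulate (newLevel ∘ x))) (oldLevel (x zero)) k
      (telescope k (oldLevel ∘ x) (newLevel ∘ x) (oldLevel≤newLevel ∘ x) gain)
      (≤-trans (+-mono-≤ first-level-bound first-level-bound) (⌊log₂⌋-square (numGreen s) k n'²≤2^k)))
  where
  s : State _
  s = beforeShortcut E t
  open Levels s (beforeShortcut-parentsBelow E t)
  open TreePath x injective green path
  first-level-bound : oldLevel (x zero) ≤ ⌊log₂ numGreen s ⌋
  first-level-bound = oldLevel≤⌊log₂numGreen⌋ (x zero)
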